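{- For every conditional relation $R$, $u(f_R(R))\subseteq f_R(u(R))$, i.e. $u$ is $f_R$-compatible.
   Context: Composition of $f\colon A\to B$, $g\colon B\to C$ is written $f;g$. Fix a category $\mathbf C$ with distinguished object $0$ and a representative class $\kappa$ of commuting squares: for every commuting square $\alpha_1;\delta_1=\alpha_2;\delta_2$ there are $(\alpha_1,\alpha_2,\beta_1,\beta_2)\in\kappa$ (a commuting square) and $\gamma$ with $\delta_1=\beta_1;\gamma$, $\delta_2=\beta_2;\gamma$; $\kappa(\alpha_1,\alpha_2)$ is the set of $(\beta_1,\beta_2)$ with $(\alpha_1,\alpha_2,\beta_1,\beta_2)\in\kappa$. Conditions over $A$ are defined inductively as $(A,\mathcal Q,S)$, $\mathcal Q\in\{\forall,\exists\}$, $S$ a finite set of pairs $(h,\mathcal A')$ with $h\colon A\to A'$, $\mathcal A'$ a condition over $A'$. For $a\colon A\to B$: $a\models(A,\forall,S)$ iff for all $(h,\mathcal A')\in S$ and all $g$ with $a=h;g$, $g\models\mathcal A'$; $a\models(A,\exists,S)$ iff some $(h,\mathcal A')\in S$ and $g$ satisfy $a=h;g$, $g\models\mathcal A'$. $\mathcal A\models\mathcal B$: every arrow satisfying $\mathcal A$ satisfies $\mathcal B$. Boolean connectives have the standard semantics. Shift along $c\colon A\to B$: $(A,\mathcal Q,S)_{\downarrow c}=(B,\mathcal Q,\{(\beta,\mathcal A'_{\downarrow\alpha})\mid(h,\mathcal A')\in S,(\alpha,\beta)\in\kappa(h,c)\})$; it satisfies $c;d\models\mathcal A\iff d\models\mathcal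 A_{\downarrow c}$. A conditional reactive system is a set $\mathcal S$ of rules $(\ell,r,\mathcal R)$, $\ell,r\colon0\to I$, $\mathcal R$ a condition over $I$. Context step $a\xrightarrow[C]{f,\ \mathcal A}a'$ ($a\colon0\to J$, $f\colon J\to K$, $a'\colon0\to K$, $\mathcal A$ over $K$): there are a rule $(\ell,r,\mathcal R)\in\mathcal S$ and $c\colon I\to K$ with $a;f=\ell;c$, $a'=r;c$, $\mathcal A\models\mathcal R_{\downarrow c}$. Representative step $a\xrightarrow[R]{f,\ \mathcal A}a'$: a context step with additionally $(f,c)\in\kappa(a,\ell)$ and $\mathcal A=\mathcal R_{\downarrow c}$. A conditional relation is a set of triples $(a,b,\mathcal C)$, $a,b\colon0\to J$, $\mathcal C$ a condition over $J$. $\mathcal D\models\bigvee_{i\in I}\mathcal E_i$ (possibly infinite $I$): every arrow satisfying $\mathcal D$ satisfies some $\mathcal E_i$. $u(R)=\{(a;d,\ b;d,\ \mathcal C_{\downarrow d})\mid(a,b,\mathcal C)\in R,\ a,b\colon0\to J,\ d\colon J\to K\}$. $f_R(R)$ is the set of triples $(a,b,\mathcal C)$ such that for each representative step $a\xrightarrow[R]{f,\ \mathcal A}a'$ there are an index set $I$, context steps $b\xrightarrow[C]{f,\ \mathcal B_i}b'_i$ and conditions $\mathcal C'_i$ with $(a',b'_i,\mathcal C'_i)\in R$ and $\mathcal A\land\mathcal C_{\downarrow f}\models\bigvee_{i\in I}(\mathcal C'_i\land\mathcal B_i)$, and symmetrically each representative step of $b$ is answered by context steps of $a$. -}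

module Defs where

open import Level using (Level; _⊔_; suc)
open import Data.Product using (Σ; Σ-syntax; _×_; _,_)
open import Data.Sum using (_⊎_)
open import Data.List using (List; []; _∷_; _++_)
open import Data.List.Membership.Propositional using (_∈_)
open import Data.Unit.Polymorphic using (⊤)
open import Data.Empty.Polymorphic using (⊥)
open import Relation.Binary.PropositionalEquality using (_≡_)
open import Relation.Unary using (Pred)

-- A category (composition written in diagrammatic order  f ⨾ g  = "f;g")
-- with a distinguished object 𝟎 and a representative class κ of
-- commuting squares.  κ(α₁,α₂) is given as a finite list of pairs
-- (β₁,β₂) (together with their common codomain), which is what makes the
-- shift of a (finitary) condition again a condition.

record CatWithReps (o ℓ : Level) : Set (suc (o ⊔ ℓ)) where
  infixl 9 _⨾_
  field
    Obj   : Set o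
    Hom   : Obj → Obj → Set ℓ
    _⨾_   : ∀ {A B C} → Hom A B → Hom B C → Hom A C
    id    : ∀ {A} → Hom A A
    idˡ   : ∀ {A B} (f : Hom A B) → id ⨾ f ≡ f
    idʳ   : ∀ {A B} (f : Hom A B) → f ⨾ id ≡ f
    assoc : ∀ {A B C D} (f : Hom A B) (g : Hom B C) (h : Hom C D) →
            (f ⨾ g) ⨾ h ≡ f ⨾ (g ⨾ h)
    𝟎     : Obj
    κ     : ∀ {A B C} → Hom A B → Hom A C → List (Σ[ D ∈ Obj ] (Hom B D × Hom C D))
    κ-commutes : ∀ {A B C D} (α₁ : Hom A B) (α₂ : Hom A C) (β₁ : Hom B D) (β₂ : Hom C D) →
                 (D , β₁ , β₂) ∈ κ α₁ α₂ → α₁ ⨾ β₁ ≡ α₂ ⨾ β₂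
    κ-rep : ∀ {A B C D} (α₁ : Hom A B) (α₂ : Hom A C) (δ₁ : Hom B D) (δ₂ : Hom C D) →
            α₁ ⨾ δ₁ ≡ α₂ ⨾ δ₂ →
            Σ[ E ∈ Obj ] Σ[ β₁ ∈ Hom B E ] Σ[ β₂ ∈ Hom C E ]
              ((E , β₁ , β₂) ∈ κ α₁ α₂ ×
               Σ[ γ ∈ Hom E D ] (δ₁ ≡ β₁ ⨾ γ × δ₂ ≡ β₂ ⨾ γ))

module Theory {o ℓ : Level} (𝐂 : CatWithReps o ℓ) where
  open CatWithReps 𝐂

  data Quant : Set where
    ∀q ∃q : Quant

  data Cond (A : Obj) : Set (o ⊔ ℓ) where
    cond : Quant → List (Σ[ A' ∈ Obj ] (Hom A A' × Cond A')) → Cond A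

  mutual
    sat : ∀ {A B} → Hom A B → Cond A → Set (o ⊔ ℓ)
    sat a (cond ∀q S) = satAll a S
    sat a (cond ∃q S) = satAny a S

    satAll : ∀ {A B} → Hom A B → List (Σ[ A' ∈ Obj ] (Hom A A' × Cond A')) → Set (o ⊔ ℓ)
    satAll a [] = ⊤
    satAll {B = B} a ((A' , h , 𝒜') ∷ S) =
      (∀ (g : Hom A' B) → a ≡ h ⨾ g → sat g 𝒜') × satAll a S

    satAny : ∀ {A B} → Hom A B → List (Σ[ A' ∈ Obj ] (Hom A A' × Cond A')) → Set (o ⊔ ℓ)
    satAny a [] = ⊥
    satAny {B = B} a ((A' , h , 𝒜') ∷ S) =
      (Σ[ g ∈ Hom A' B ] (a ≡ h ⨾ g × sat g 𝒜')) ⊎ satAny a S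

  _⊨_ : ∀ {A} → Cond A → Cond A → Set (o ⊔ ℓ)
  _⊨_ {A} 𝒜 ℬ = ∀ {B} (x : Hom A B) → sat x 𝒜 → sat x ℬ

  mutual
    shift : ∀ {A B} → Cond A → Hom A B → Cond B
    shift (cond Q S) c = cond Q (shiftS S c)

    shiftS : ∀ {A B} → List (Σ[ A' ∈ Obj ] (Hom A A' × Cond A')) → Hom A B →
             List (Σ[ D ∈ Obj ] (Hom B D × Cond D))
    shiftS [] c = []
    shiftS ((A' , h , 𝒜') ∷ S) c = shiftK (κ h c) 𝒜' ++ shiftS S c

    shiftK : ∀ {A' B} → List (Σ[ D ∈ Obj ] (Hom A' D × Hom B D)) → Cond A' →
             List (Σ[ D ∈ Obj ] (Hom B D × Cond D))
    shiftK [] 𝒜' = []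
    shiftK ((D , α , β) ∷ ks) 𝒜' = (D , β , shift 𝒜' α) ∷ shiftK ks 𝒜'

  Rule : Set (o ⊔ ℓ)
  Rule = Σ[ I ∈ Obj ] (Hom 𝟎 I × Hom 𝟎 I × Cond I)

  Triple : Set (o ⊔ ℓ)
  Triple = Σ[ J ∈ Obj ] (Hom 𝟎 J × Hom 𝟎 J × Cond J)

  CondRel : (p : Level) → Set (o ⊔ ℓ ⊔ suc p)
  CondRel p = Pred Triple p

  swapT : Triple → Triple
  swapT (J , a , b , 𝒞) = (J , b , a , 𝒞)

  u : ∀ {p} → CondRel p → CondRel (o ⊔ ℓ ⊔ p)
  u R t = Σ[ J ∈ Obj ] Σ[ a ∈ Hom 𝟎 J ] Σ[ b ∈ Hom 𝟎 J ] Σ[ 𝒞 ∈ Cond J ]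
          Σ[ K ∈ Obj ] Σ[ d ∈ Hom J K ]
            (R (J , a , b , 𝒞) × t ≡ (K , a ⨾ d , b ⨾ d , shift 𝒞 d))

  module Reactive {s : Level} (𝒮 : Pred Rule s) where

    ContextStep : ∀ {J K} → Hom 𝟎 J → Hom J K → Cond K → Hom 𝟎 K → Set (o ⊔ ℓ ⊔ s)
    ContextStep {J} {K} a f 𝒜 a' =
      Σ[ I ∈ Obj ] Σ[ l ∈ Hom 𝟎 I ] Σ[ r ∈ Hom 𝟎 I ] Σ[ ℛ ∈ Cond I ]
        (𝒮 (I , l , r , ℛ) ×
         Σ[ c ∈ Hom I K ] (a ⨾ f ≡ l ⨾ c × a' ≡ r ⨾ c × 𝒜 ⊨ shift ℛ c))

    RepStep : ∀ {J K} → Hom 𝟎 J → Hom J K → Cond K → Hom 𝟎 K → Set (o ⊔ ℓ ⊔ s)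
    RepStep {J} {K} a f 𝒜 a' =
      Σ[ I ∈ Obj ] Σ[ l ∈ Hom 𝟎 I ] Σ[ r ∈ Hom 𝟎 I ] Σ[ ℛ ∈ Cond I ]
        (𝒮 (I , l , r , ℛ) ×
         Σ[ c ∈ Hom I K ] ((a ⨾ f ≡ l ⨾ c × a' ≡ r ⨾ c × 𝒜 ⊨ shift ℛ c) ×
                           ((K , f , c) ∈ κ a l × 𝒜 ≡ shift ℛ c)))

    -- one half of the transfer property: every representative step of a
    -- is answered by a family (indexed by a set I) of context steps of b
    -- with  𝒜 ∧ 𝒞↓f ⊨ ⋁_{i∈I} (𝒞'ᵢ ∧ ℬᵢ)
    Answers : ∀ {p} → CondRel p → ∀ {J} → Hom 𝟎 J → Hom 𝟎 J → Cond J →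
              Set (suc (o ⊔ ℓ ⊔ s ⊔ p))
    Answers {p} R {J} a b 𝒞 =
      ∀ {K} (f : Hom J K) (𝒜 : Cond K) (a' : Hom 𝟎 K) → RepStep a f 𝒜 a' →
        Σ[ I ∈ Set (o ⊔ ℓ ⊔ s ⊔ p) ]
        Σ[ b' ∈ (I → Hom 𝟎 K) ] Σ[ ℬ ∈ (I → Cond K) ] Σ[ 𝒞' ∈ (I → Cond K) ]
          ((∀ i → ContextStep b f (ℬ i) (b' i)) ×
           (∀ i → R (K , a' , b' i , 𝒞' i)) ×
           (∀ {X} (x : Hom K X) → sat x 𝒜 → sat x (shift 𝒞 f) →
              Σ[ i ∈ I ] (sat x (𝒞' i) × sat x (ℬ i))))

    f-R : ∀ {p} → CondRel p → CondRel (suc (o ⊔ ℓ ⊔ s ⊔ p))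
    f-R R (J , a , b , 𝒞) =
      Answers R a b 𝒞 × Answers (λ t → R (swapT t)) b a 𝒞

module Submission where

-- A triple of u (f_R R) has the form (a;d, b;d, 𝒞↓d) with (a, b, 𝒞) ∈ f_R R.
-- Its transfer property follows from that of (a, b, 𝒞) in three steps.
--
--  1. Shift semantics: c;d ⊨ 𝒜  iff  d ⊨ 𝒜↓c, proved by mutual induction on
--     conditions, with some bookkeeping for satisfaction of ∀/∃-lists.
--  2. Factorisation: every context step of a;d along f factors through a
--     representative step of a along some f' with d;f = f';γ (using the
--     representative square of a;(d;f) = ℓ;c).  Context steps are moreover
--     stable under post-composition with γ.
--  3. Answers transfer along d: the answer to the factored representative
--     step of a, post-composed with γ, answers the original step of a;d,
--     and its related triples, shifted along γ, lie in u R.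
--
-- The theorem applies step 3 to both halves of the transfer property.

open import Defs
open import Level using (Level; _⊔_)
open import Relation.Unary using (Pred; _⊆_)
open import Data.Product using (Σ-syntax; _×_; _,_)
open import Data.Sum using (_⊎_; inj₁; inj₂)
open import Data.List using (List; []; _∷_; _++_)
open import Data.List.Relation.Unary.Any using (here; there)
open import Data.List.Membership.Propositional using (_∈_)
open import Data.Unit.Polymorphic using (tt)
open import Relation.Binary.PropositionalEquality
  using (_≡_; refl; sym; trans; cong; subst; module ≡-Reasoning)

module ShiftSemantics {o ℓ : Level} (𝐂 : CatWithReps o ℓ) where
  open CatWithReps 𝐂
  open Theory 𝐂
  open ≡-Reasoning

  Branches : Obj → Set (o ⊔ ℓ)
  Branches A = List (Σ[ A' ∈ Obj ] (Hom A A' × Cond A'))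

  extend-square : ∀ {A B C D X} {f : Hom A B} {g : Hom B D} {f' : Hom A C} {g' : Hom C D} →
                  f ⨾ g ≡ f' ⨾ g' → (x : Hom D X) → f ⨾ (g ⨾ x) ≡ f' ⨾ (g' ⨾ x)
  extend-square {f = f} {g} {f'} {g'} sq x = begin
    f ⨾ (g ⨾ x)    ≡⟨ assoc f g x ⟨
    (f ⨾ g) ⨾ x    ≡⟨ cong (_⨾ x) sq ⟩
    (f' ⨾ g') ⨾ x  ≡⟨ assoc f' g' x ⟩
    f' ⨾ (g' ⨾ x)  ∎

  κ-factor : ∀ {A A' B D X} (h : Hom A A') (c : Hom A B) {α : Hom A' D} {β : Hom B D}
             {d : Hom B X} (g' : Hom D X) →
             (D , α , β) ∈ κ h c → d ≡ β ⨾ g' → c ⨾ d ≡ h ⨾ (α ⨾ g')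
  κ-factor h c {α} {β} {d} g' m d≡ = begin
    c ⨾ d          ≡⟨ cong (c ⨾_) d≡ ⟩
    c ⨾ (β ⨾ g')   ≡⟨ extend-square (sym (κ-commutes h c α β m)) g' ⟩
    h ⨾ (α ⨾ g')   ∎

  satAll-++⁻ : ∀ {B X} {d : Hom B X} (xs ys : Branches B) →
               satAll d (xs ++ ys) → satAll d xs × satAll d ys
  satAll-++⁻ []       ys H = tt , H
  satAll-++⁻ (x ∷ xs) ys (h , H) with satAll-++⁻ xs ys H
  ... | Hxs , Hys = (h , Hxs) , Hys

  satAll-++⁺ : ∀ {B X} {d : Hom B X} (xs ys : Branches B) →
               satAll d xs → satAll d ys → satAll d (xs ++ ys)
  satAll-++⁺ []       ys _         Hys = Hys
  satAll-++⁺ (x ∷ xs) ys (h , Hxs) Hys = h , satAll-++⁺ xs ys Hxs Hys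

  satAny-++⁻ : ∀ {B X} {d : Hom B X} (xs ys : Branches B) →
               satAny d (xs ++ ys) → satAny d xs ⊎ satAny d ys
  satAny-++⁻ []       ys H        = inj₂ H
  satAny-++⁻ (x ∷ xs) ys (inj₁ h) = inj₁ (inj₁ h)
  satAny-++⁻ (x ∷ xs) ys (inj₂ H) with satAny-++⁻ xs ys H
  ... | inj₁ h = inj₁ (inj₂ h)
  ... | inj₂ h = inj₂ h

  satAny-++⁺ˡ : ∀ {B X} {d : Hom B X} (xs ys : Branches B) →
                satAny d xs → satAny d (xs ++ ys)
  satAny-++⁺ˡ (x ∷ xs) ys (inj₁ h) = inj₁ h
  satAny-++⁺ˡ (x ∷ xs) ys (inj₂ h) = inj₂ (satAny-++⁺ˡ xs ys h)

  satAny-++⁺ʳ : ∀ {B X} {d : Hom B X} (xs ys : Branches B) →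
                satAny d ys → satAny d (xs ++ ys)
  satAny-++⁺ʳ []       ys h = h
  satAny-++⁺ʳ (x ∷ xs) ys h = inj₂ (satAny-++⁺ʳ xs ys h)

  satAll-shiftK⁻ : ∀ {A' B X} (𝒜' : Cond A') {d : Hom B X}
                   (ks : List (Σ[ D ∈ Obj ] (Hom A' D × Hom B D))) →
                   satAll d (shiftK ks 𝒜') → ∀ {D α β} → (D , α , β) ∈ ks →
                   ∀ g' → d ≡ β ⨾ g' → sat g' (shift 𝒜' α)
  satAll-shiftK⁻ 𝒜' (k ∷ ks) (H , Hs) (here refl) = H
  satAll-shiftK⁻ 𝒜' (k ∷ ks) (H , Hs) (there m)   = satAll-shiftK⁻ 𝒜' ks Hs m

  satAll-shiftK⁺ : ∀ {A' B X} (𝒜' : Cond A') {d : Hom B X}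
                   (ks : List (Σ[ D ∈ Obj ] (Hom A' D × Hom B D))) →
                   (∀ {D α β} → (D , α , β) ∈ ks → ∀ g' → d ≡ β ⨾ g' → sat g' (shift 𝒜' α)) →
                   satAll d (shiftK ks 𝒜')
  satAll-shiftK⁺ 𝒜' []       H = tt
  satAll-shiftK⁺ 𝒜' (k ∷ ks) H = H (here refl) , satAll-shiftK⁺ 𝒜' ks (λ m → H (there m))

  satAny-shiftK⁺ : ∀ {A' B X} (𝒜' : Cond A') {d : Hom B X}
                   (ks : List (Σ[ D ∈ Obj ] (Hom A' D × Hom B D))) →
                   ∀ {D α β} → (D , α , β) ∈ ks → ∀ g' → d ≡ β ⨾ g' → sat g' (shift 𝒜' α) →
                   satAny d (shiftK ks 𝒜')
  satAny-shiftK⁺ 𝒜' (k ∷ ks) (here refl) g' d≡ h = inj₁ (g' , d≡ , h)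
  satAny-shiftK⁺ 𝒜' (k ∷ ks) (there m)   g' d≡ h = inj₂ (satAny-shiftK⁺ 𝒜' ks m g' d≡ h)

  satAny-shiftK⁻ : ∀ {A' B X} (𝒜' : Cond A') {d : Hom B X}
                   (ks : List (Σ[ D ∈ Obj ] (Hom A' D × Hom B D))) →
                   satAny d (shiftK ks 𝒜') →
                   Σ[ D ∈ Obj ] Σ[ α ∈ Hom A' D ] Σ[ β ∈ Hom B D ] Σ[ g' ∈ Hom D X ]
                     ((D , α , β) ∈ ks × d ≡ β ⨾ g' × sat g' (shift 𝒜' α))
  satAny-shiftK⁻ 𝒜' ((D , α , β) ∷ ks) (inj₁ (g' , d≡ , h)) = D , α , β , g' , here refl , d≡ , h
  satAny-shiftK⁻ 𝒜' (k ∷ ks) (inj₂ H) with satAny-shiftK⁻ 𝒜' ks H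
  ... | D , α , β , g' , m , d≡ , h = D , α , β , g' , there m , d≡ , h

  mutual
    shift-complete : ∀ {A B X} (𝒜 : Cond A) (c : Hom A B) (d : Hom B X) →
                     sat (c ⨾ d) 𝒜 → sat d (shift 𝒜 c)
    shift-complete (cond ∀q S) = shift-completeAll S
    shift-complete (cond ∃q S) = shift-completeAny S

    shift-completeAll : ∀ {A B X} (S : Branches A) (c : Hom A B) (d : Hom B X) →
                        satAll (c ⨾ d) S → satAll d (shiftS S c)
    shift-completeAll [] c d _ = tt
    shift-completeAll ((A' , h , 𝒜') ∷ S) c d (H , Hs) =
      satAll-++⁺ (shiftK (κ h c) 𝒜') (shiftS S c)
        (satAll-shiftK⁺ 𝒜' (κ h c) (λ {_} {α} m g' d≡ →
           shift-complete 𝒜' α g' (H (α ⨾ g') (κ-factor h c g' m d≡))))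
        (shift-completeAll S c d Hs)

    -- a witness g of c;d = h;g is recovered from its representative square
    shift-completeAny : ∀ {A B X} (S : Branches A) (c : Hom A B) (d : Hom B X) →
                        satAny (c ⨾ d) S → satAny d (shiftS S c)
    shift-completeAny ((A' , h , 𝒜') ∷ S) c d (inj₁ (g , c⨾d≡ , Hg))
      with κ-rep h c g d (sym c⨾d≡)
    ... | _ , β₁ , _ , m , γ , g≡ , d≡ =
      satAny-++⁺ˡ (shiftK (κ h c) 𝒜') (shiftS S c)
        (satAny-shiftK⁺ 𝒜' (κ h c) m γ d≡
          (shift-complete 𝒜' β₁ γ (subst (λ z → sat z 𝒜') g≡ Hg)))
    shift-completeAny ((A' , h , 𝒜') ∷ S) c d (inj₂ H) =
      satAny-++⁺ʳ (shiftK (κ h c) 𝒜') (shiftS S c) (shift-completeAny S c d H)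

  mutual
    shift-sound : ∀ {A B X} (𝒜 : Cond A) (c : Hom A B) (d : Hom B X) →
                  sat d (shift 𝒜 c) → sat (c ⨾ d) 𝒜
    shift-sound (cond ∀q S) = shift-soundAll S
    shift-sound (cond ∃q S) = shift-soundAny S

    -- every g with c;d = h;g factors through a representative square of (h, c)
    shift-soundAll : ∀ {A B X} (S : Branches A) (c : Hom A B) (d : Hom B X) →
                     satAll d (shiftS S c) → satAll (c ⨾ d) S
    shift-soundAll [] c d _ = tt
    shift-soundAll ((A' , h , 𝒜') ∷ S) c d H
      with satAll-++⁻ (shiftK (κ h c) 𝒜') (shiftS S c) H
    ... | Hh , HS = satBranch , shift-soundAll S c d HS
      where
      satBranch : ∀ g → c ⨾ d ≡ h ⨾ g → sat g 𝒜'
      satBranch g c⨾d≡ with κ-rep h c g d (sym c⨾d≡)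
      ... | _ , β₁ , _ , m , γ , g≡ , d≡ =
        subst (λ z → sat z 𝒜') (sym g≡)
          (shift-sound 𝒜' β₁ γ (satAll-shiftK⁻ 𝒜' (κ h c) Hh m γ d≡))

    shift-soundAny : ∀ {A B X} (S : Branches A) (c : Hom A B) (d : Hom B X) →
                     satAny d (shiftS S c) → satAny (c ⨾ d) S
    shift-soundAny ((A' , h , 𝒜') ∷ S) c d H
      with satAny-++⁻ (shiftK (κ h c) 𝒜') (shiftS S c) H
    ... | inj₂ HS = inj₂ (shift-soundAny S c d HS)
    ... | inj₁ Hh with satAny-shiftK⁻ 𝒜' (κ h c) Hh
    ... | D , α , β , g' , m , d≡ , Hg' =
      inj₁ (α ⨾ g' , κ-factor h c g' m d≡ , shift-sound 𝒜' α g' Hg')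

  shift-transport : ∀ {A B B' X} (𝒜 : Cond A) {c : Hom A B} {c' : Hom A B'}
                    {x : Hom B X} {x' : Hom B' X} →
                    c ⨾ x ≡ c' ⨾ x' → sat x (shift 𝒜 c) → sat x' (shift 𝒜 c')
  shift-transport 𝒜 {c} {c'} {x} {x'} eq h =
    shift-complete 𝒜 c' x' (subst (λ z → sat z 𝒜) eq (shift-sound 𝒜 c x h))

module ReactiveSteps {o ℓ s : Level} (𝐂 : CatWithReps o ℓ) (𝒮 : Pred (Theory.Rule 𝐂) s) where
  open CatWithReps 𝐂
  open Theory 𝐂
  open Reactive 𝒮
  open ShiftSemantics 𝐂
  open ≡-Reasoning

  repStep⇒contextStep : ∀ {J K} {a : Hom 𝟎 J} {f : Hom J K} {𝒜 : Cond K} {a' : Hom 𝟎 K} →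
                        RepStep a f 𝒜 a' → ContextStep a f 𝒜 a'
  repStep⇒contextStep (I , l , r , ℛ , s∈ , c , step , _) = I , l , r , ℛ , s∈ , c , step

  contextStep-along : ∀ {J J' K} {a : Hom 𝟎 J} {f : Hom J K} {a₁ : Hom 𝟎 J'} {f₁ : Hom J' K}
                      {ℬ : Cond K} {b' : Hom 𝟎 K} →
                      a ⨾ f ≡ a₁ ⨾ f₁ → ContextStep a f ℬ b' → ContextStep a₁ f₁ ℬ b'
  contextStep-along eq (I , l , r , ℛ , s∈ , c , a⨾f≡ , b'≡ , ent) =
    I , l , r , ℛ , s∈ , c , trans (sym eq) a⨾f≡ , b'≡ , ent

  contextStep-extend : ∀ {J K L} {b : Hom 𝟎 J} {f : Hom J K} {ℬ : Cond K} {b' : Hom 𝟎 K}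
                       (γ : Hom K L) →
                       ContextStep b f ℬ b' → ContextStep b (f ⨾ γ) (shift ℬ γ) (b' ⨾ γ)
  contextStep-extend {b = b} {f} {ℬ} γ (I , l , r , ℛ , s∈ , c , b⨾f≡ , b'≡ , ent) =
    I , l , r , ℛ , s∈ , c ⨾ γ ,
    trans (sym (assoc b f γ)) (trans (cong (_⨾ γ) b⨾f≡) (assoc l c γ)) ,
    trans (cong (_⨾ γ) b'≡) (assoc r c γ) ,
    λ x h → shift-transport ℛ (sym (assoc c γ x)) (ent (γ ⨾ x) (shift-sound ℬ γ x h))

  record Factorisation {J K L} (a : Hom 𝟎 J) (d : Hom J K) (f : Hom K L)
                       (𝒜 : Cond L) (a' : Hom 𝟎 L) : Set (o ⊔ ℓ ⊔ s) where
    field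
      {M}       : Obj
      f'        : Hom J M
      γ         : Hom M L
      𝒜'        : Cond M
      a''       : Hom 𝟎 M
      step      : RepStep a f' 𝒜' a''
      square    : d ⨾ f ≡ f' ⨾ γ
      result    : a' ≡ a'' ⨾ γ
      condition : ∀ {X} (x : Hom L X) → sat x 𝒜 → sat (γ ⨾ x) 𝒜'

  -- Every context step of a;d factors through a representative step of a:
  -- take the representative square of a;(d;f) = l;c.
  factorise : ∀ {J K L} (a : Hom 𝟎 J) (d : Hom J K) {f : Hom K L} {𝒜 : Cond L} {a' : Hom 𝟎 L} →
              ContextStep (a ⨾ d) f 𝒜 a' → Factorisation a d f 𝒜 a'
  factorise {L = L} a d {f} (I , l , r , ℛ , s∈ , c , a⨾d⨾f≡ , a'≡ , ent)
    with κ-rep a l (d ⨾ f) c (trans (sym (assoc a d f)) a⨾d⨾f≡)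
  ... | _ , f' , c' , m , γ , d⨾f≡ , c≡ = record
    { f'        = f'
    ; γ         = γ
    ; 𝒜'        = shift ℛ c'
    ; a''       = r ⨾ c'
    ; step      = I , l , r , ℛ , s∈ , c' ,
                  (κ-commutes a l f' c' m , refl , (λ x h → h)) , m , refl
    ; square    = d⨾f≡
    ; result    = trans a'≡ (trans (cong (r ⨾_) c≡) (sym (assoc r c' γ)))
    ; condition = λ x h → shift-transport ℛ (c⨾x≡ x) (ent x h)
    }
    where
    c⨾x≡ : ∀ {X} (x : Hom L X) → c ⨾ x ≡ c' ⨾ (γ ⨾ x)
    c⨾x≡ x = trans (cong (_⨾ x) c≡) (assoc c' γ x)

  answers-extend : ∀ {p} (R : CondRel p) (R' : CondRel (o ⊔ ℓ ⊔ p)) →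
                   (∀ {J K} (a b : Hom 𝟎 J) (𝒞 : Cond J) (d : Hom J K) →
                      R (J , a , b , 𝒞) → R' (K , a ⨾ d , b ⨾ d , shift 𝒞 d)) →
                   ∀ {J K} (a b : Hom 𝟎 J) (𝒞 : Cond J) (d : Hom J K) →
                   Answers R a b 𝒞 → Answers R' (a ⨾ d) (b ⨾ d) (shift 𝒞 d)
  answers-extend R R' extend a b 𝒞 d answers {L} f 𝒜 a' repStep
    with factorise a d {f} {𝒜} {a'} (repStep⇒contextStep repStep)
  ... | record { f' = f' ; γ = γ ; 𝒜' = 𝒜' ; a'' = a'' ; step = step ; square = square
               ; result = result ; condition = condition }
    with answers f' 𝒜' a'' step
  ... | I , b' , ℬ , 𝒞' , steps , related , covers =
    I , (λ i → b' i ⨾ γ) , (λ i → shift (ℬ i) γ) , (λ i → shift (𝒞' i) γ) ,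
    (λ i → contextStep-along {ℬ = shift (ℬ i) γ} b⨾d⨾f≡
               (contextStep-extend {ℬ = ℬ i} γ (steps i))) ,
    (λ i → subst (λ z → R' (L , z , b' i ⨾ γ , shift (𝒞' i) γ)) (sym result)
             (extend a'' (b' i) (𝒞' i) γ (related i))) ,
    coversShifted
    where
    b⨾d⨾f≡ : b ⨾ (f' ⨾ γ) ≡ (b ⨾ d) ⨾ f
    b⨾d⨾f≡ = begin
      b ⨾ (f' ⨾ γ)  ≡⟨ cong (b ⨾_) square ⟨
      b ⨾ (d ⨾ f)   ≡⟨ assoc b d f ⟨
      (b ⨾ d) ⨾ f   ∎

    coversShifted : ∀ {X} (x : Hom L X) → sat x 𝒜 → sat x (shift (shift 𝒞 d) f) →
                    Σ[ i ∈ I ] (sat x (shift (𝒞' i) γ) × sat x (shift (ℬ i) γ))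
    coversShifted x h𝒜 h𝒞 with covers (γ ⨾ x) (condition x h𝒜)
      (shift-transport 𝒞 (extend-square square x) (shift-sound (shift 𝒞 d) f x h𝒞))
    ... | i , h𝒞' , hℬ = i , shift-complete (𝒞' i) γ x h𝒞' , shift-complete (ℬ i) γ x hℬ

corollary5p18 : ∀ {o ℓ s p : Level} (𝐂 : CatWithReps o ℓ)
                  (𝒮 : Pred (Theory.Rule 𝐂) s) (R : Theory.CondRel 𝐂 p) →
                  Theory.u 𝐂 (Theory.Reactive.f-R 𝐂 𝒮 R) ⊆ Theory.Reactive.f-R 𝐂 𝒮 (Theory.u 𝐂 R)
corollary5p18 𝐂 𝒮 R (_ , a , b , 𝒞 , _ , d , (answersA , answersB) , refl) =
  answers-extend R (u R) inU a b 𝒞 d answersA ,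
  answers-extend (λ t → R (swapT t)) (λ t → u R (swapT t)) inUSwapped b a 𝒞 d answersB
  where
  open Theory 𝐂
  open ReactiveSteps 𝐂 𝒮
  open CatWithReps 𝐂 using (Hom; 𝟎; _⨾_)

  inU : ∀ {J K} (a₀ b₀ : Hom 𝟎 J) (𝒞₀ : Cond J) (d₀ : Hom J K) →
        R (J , a₀ , b₀ , 𝒞₀) → u R (K , a₀ ⨾ d₀ , b₀ ⨾ d₀ , shift 𝒞₀ d₀)
  inU a₀ b₀ 𝒞₀ d₀ r = _ , a₀ , b₀ , 𝒞₀ , _ , d₀ , r , refl

  inUSwapped : ∀ {J K} (b₀ a₀ : Hom 𝟎 J) (𝒞₀ : Cond J) (d₀ : Hom J K) →
               R (J , a₀ , b₀ , 𝒞₀) → u R (K , a₀ ⨾ d₀ , b₀ ⨾ d₀ , shift 𝒞₀ d₀)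
  inUSwapped b₀ a₀ = inU a₀ b₀
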